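{- Let $k\ge 3$. If $G$ is a class-proper interval $k$-graph, then $G$ is a cocomparability graph.
   Context: All graphs are finite and simple. A graph $G$ is an interval $k$-graph if there is a one-to-one correspondence $v\mapsto I_v$ between $V(G)$ and a family of closed intervals of the real line, together with a partition of the family into at most $k$ classes, such that distinct vertices $u,v$ are adjacent if and only if $I_u\cap I_v\neq\emptyset$ and $I_u,I_v$ lie in different classes. It is a class-proper interval $k$-graph if it has such a representation in which no interval properly contains another interval of the same class. A cocomparability graph is a graph whose complement admits a transitive orientation (equivalently, the incomparability graph of a strict partial order).
   Formalization: The closed intervals in the class-proper interval k-representation of $G$ have rational endpoints rather than real ones. -}

module Defs where

open import Data.Nat using (ℕ)
open import Data.Fin using (Fin)
open import Data.Rational using (ℚ; _≤_)
open import Data.Product using (Σ; _×_; _,_)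
open import Data.Sum using (_⊎_)
open import Relation.Nullary using (¬_)
open import Relation.Binary.PropositionalEquality using (_≡_; _≢_)
open import Level using (0ℓ; suc)

record Graph (n : ℕ) : Set₁ where
  field
    Adj   : Fin n → Fin n → Set
    irrefl : ∀ v → ¬ Adj v v
    sym   : ∀ {u v} → Adj u v → Adj v u
open Graph public

record Interval : Set where
  constructor [_,_∣_]
  field
    left  : ℚ
    right : ℚ
    wf    : left ≤ right
open Interval public

Meets : Interval → Interval → Set
Meets I J = (left I ≤ right J) × (left J ≤ right I)

ProperlyIn : Interval → Interval → Set
ProperlyIn I J = (left J ≤ left I) × (right I ≤ right J)
                 × ¬ ((left I ≡ left J) × (right I ≡ right J))

record IntervalRep {n : ℕ} (k : ℕ) (G : Graph n) : Set where
  field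
    I     : Fin n → Interval
    class : Fin n → Fin k
    adj⇔  : ∀ u v → u ≢ v →
            (Adj G u v → Meets (I u) (I v) × class u ≢ class v)
            × (Meets (I u) (I v) × class u ≢ class v → Adj G u v)
open IntervalRep public

IsIntervalKGraph : {n : ℕ} → ℕ → Graph n → Set
IsIntervalKGraph k G = IntervalRep k G

IsClassProperIntervalKGraph : {n : ℕ} → ℕ → Graph n → Set
IsClassProperIntervalKGraph k G =
  Σ (IntervalRep k G) λ R →
    ∀ u v → class R u ≡ class R v → ¬ ProperlyIn (I R u) (I R v)

record ComplementTransitiveOrientation {n : ℕ} (G : Graph n) : Set₁ where
  field
    _⇒_      : Fin n → Fin n → Set
    onNonEdge : ∀ {u v} → u ⇒ v → (u ≢ v) × ¬ Adj G u v
    total     : ∀ u v → u ≢ v → ¬ Adj G u v → (u ⇒ v) ⊎ (v ⇒ u)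
    asym      : ∀ {u v} → u ⇒ v → ¬ (v ⇒ u)
    trans     : ∀ {u v w} → u ⇒ v → v ⇒ w → u ⇒ w

IsCocomparability : {n : ℕ} → Graph n → Set₁
IsCocomparability G = ComplementTransitiveOrientation G

{-# OPTIONS --safe #-}
-- Order the vertices lexicographically by (left endpoint, right endpoint, index)
-- and orient every non-edge upwards. A non-edge u ≺ v either stays within one
-- class, where class-properness puts the right endpoints in the same order as
-- the left ones, or joins disjoint intervals with I u entirely left of I v.
-- Hence right endpoints never decrease along a non-edge and jump past the next
-- left endpoint whenever the class changes. For non-edges u ≺ v ≺ w with u and w
-- in different classes one of the two steps changes class, so I w starts after
-- I u ends and u, w are not adjacent: the orientation is transitive.
module Submission where

open import Defs
open import Data.Nat using (ℕ; _≤_)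
open import Data.Fin using (Fin)
import Data.Fin.Properties as Fin
open import Data.Rational using (ℚ) renaming (_<_ to _<ℚ_; _≤_ to _≤ℚ_)
open import Data.Rational.Properties
  using (<⇒≤; ≤-reflexive; ≤-trans; ≰⇒>; <⇒≢; <-irrefl; _≤?_; module ≤-Reasoning)
  renaming (<-strictTotalOrder to ℚ-<-strictTotalOrder)
open import Data.Product using (_×_; _,_; proj₁; proj₂)
open import Data.Product.Relation.Binary.Lex.Strict using (×-strictTotalOrder)
open import Data.Sum using (_⊎_; inj₁; inj₂)
open import Data.Empty using (⊥-elim)
open import Function using (_∘_)
open import Level using (0ℓ)
open import Relation.Nullary using (¬_; yes; no; contradiction)
open import Relation.Binary.Bundles using (StrictTotalOrder)
open import Relation.Binary.Definitions using (tri<; tri≈; tri>)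
open import Relation.Binary.PropositionalEquality as ≡ using (_≡_; _≢_; refl)

ClassProper : {n k : ℕ} {G : Graph n} → IntervalRep k G → Set
ClassProper R = ∀ u v → class R u ≡ class R v → ¬ ProperlyIn (I R u) (I R v)

module ComplementOrientation {n k : ℕ} {G : Graph n}
  (R : IntervalRep k G) (proper : ClassProper R) where

  lft rgt : Fin n → ℚ
  lft u = left (I R u)
  rgt u = right (I R u)

  lexOrder : StrictTotalOrder 0ℓ 0ℓ 0ℓ
  lexOrder = ×-strictTotalOrder ℚ-<-strictTotalOrder
               (×-strictTotalOrder ℚ-<-strictTotalOrder (Fin.<-strictTotalOrder n))

  module Lex = StrictTotalOrder lexOrder

  key : Fin n → ℚ × ℚ × Fin n
  key u = lft u , rgt u , u

  _≺_ : Fin n → Fin n → Set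
  u ≺ v = key u Lex.< key v

  ≺-irrefl : ∀ {u} → ¬ u ≺ u
  ≺-irrefl = Lex.irrefl Lex.Eq.refl

  ≺⇒≢ : ∀ {u v} → u ≺ v → u ≢ v
  ≺⇒≢ u≺v refl = ≺-irrefl u≺v

  ≢⇒≺⊎≻ : ∀ {u v} → u ≢ v → u ≺ v ⊎ v ≺ u
  ≢⇒≺⊎≻ {u} {v} u≢v with Lex.compare (key u) (key v)
  ... | tri< u≺v _ _ = inj₁ u≺v
  ... | tri≈ _ u≈v _ = contradiction (proj₂ (proj₂ u≈v)) u≢v
  ... | tri> _ _ v≺u = inj₂ v≺u

  ≺⇒lft≤ : ∀ {u v} → u ≺ v → lft u ≤ℚ lft v
  ≺⇒lft≤ (inj₁ lu<lv)        = <⇒≤ lu<lv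
  ≺⇒lft≤ (inj₂ (lu≡lv , _)) = ≤-reflexive lu≡lv

  sameClass-≺⇒rgt≤ : ∀ {u v} → class R u ≡ class R v → u ≺ v → rgt u ≤ℚ rgt v
  sameClass-≺⇒rgt≤ _ (inj₂ (_ , inj₁ ru<rv))        = <⇒≤ ru<rv
  sameClass-≺⇒rgt≤ _ (inj₂ (_ , inj₂ (ru≡rv , _))) = ≤-reflexive ru≡rv
  sameClass-≺⇒rgt≤ {u} {v} cu≡cv (inj₁ lu<lv) with rgt u ≤? rgt v
  ... | yes ru≤rv = ru≤rv
  ... | no ru≰rv  = ⊥-elim (proper v u (≡.sym cu≡cv)
                      (<⇒≤ lu<lv , <⇒≤ (≰⇒> ru≰rv) , λ (lv≡lu , _) → <⇒≢ lu<lv (≡.sym lv≡lu)))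

  ¬Meets-≺⇒rgt<lft : ∀ {u v} → ¬ Meets (I R u) (I R v) → u ≺ v → rgt u <ℚ lft v
  ¬Meets-≺⇒rgt<lft {u} {v} disjoint u≺v with lft v ≤? rgt u
  ... | yes lv≤ru = ⊥-elim (disjoint (≤-trans (≺⇒lft≤ u≺v) (wf (I R v)) , lv≤ru))
  ... | no lv≰ru  = ≰⇒> lv≰ru

  nonAdjacent-classDiff⇒¬Meets : ∀ {u v} → u ≢ v → ¬ Adj G u v →
                                 class R u ≢ class R v → ¬ Meets (I R u) (I R v)
  nonAdjacent-classDiff⇒¬Meets {u} {v} u≢v ¬adj cu≢cv meets =
    ¬adj (proj₂ (adj⇔ R u v u≢v) (meets , cu≢cv))

  _⇒_ : Fin n → Fin n → Set
  u ⇒ v = ¬ Adj G u v × u ≺ v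

  ⇒-classDiff⇒rgt<lft : ∀ {u v} → u ⇒ v → class R u ≢ class R v → rgt u <ℚ lft v
  ⇒-classDiff⇒rgt<lft (¬adj , u≺v) cu≢cv =
    ¬Meets-≺⇒rgt<lft (nonAdjacent-classDiff⇒¬Meets (≺⇒≢ u≺v) ¬adj cu≢cv) u≺v

  ⇒-rgt≤ : ∀ {u v} → u ⇒ v → rgt u ≤ℚ rgt v
  ⇒-rgt≤ {u} {v} u⇒v with class R u Fin.≟ class R v
  ... | yes cu≡cv = sameClass-≺⇒rgt≤ cu≡cv (proj₂ u⇒v)
  ... | no cu≢cv  = <⇒≤ (begin-strict
    rgt u  <⟨ ⇒-classDiff⇒rgt<lft u⇒v cu≢cv ⟩
    lft v  ≤⟨ wf (I R v) ⟩
    rgt v  ∎)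
    where open ≤-Reasoning

  ⇒-trans : ∀ {u v w} → u ⇒ v → v ⇒ w → u ⇒ w
  ⇒-trans {u} {v} {w} u⇒v@(_ , u≺v) v⇒w@(_ , v≺w) = ¬adj , u≺w
    where
    u≺w : u ≺ w
    u≺w = Lex.trans u≺v v≺w

    open ≤-Reasoning

    ¬adj : ¬ Adj G u w
    ¬adj adj with proj₁ (adj⇔ R u w (≺⇒≢ u≺w)) adj | class R u Fin.≟ class R v
    ... | (_ , lw≤ru) , cu≢cw | yes cu≡cv = <-irrefl refl (begin-strict
      rgt u  ≤⟨ ⇒-rgt≤ u⇒v ⟩
      rgt v  <⟨ ⇒-classDiff⇒rgt<lft v⇒w (λ cv≡cw → cu≢cw (≡.trans cu≡cv cv≡cw)) ⟩
      lft w  ≤⟨ lw≤ru ⟩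
      rgt u  ∎)
    ... | (_ , lw≤ru) , _ | no cu≢cv = <-irrefl refl (begin-strict
      rgt u  <⟨ ⇒-classDiff⇒rgt<lft u⇒v cu≢cv ⟩
      lft v  ≤⟨ ≺⇒lft≤ v≺w ⟩
      lft w  ≤⟨ lw≤ru ⟩
      rgt u  ∎)

  complementOrientation : ComplementTransitiveOrientation G
  complementOrientation = record
    { _⇒_       = _⇒_
    ; onNonEdge = λ (¬adj , u≺v) → ≺⇒≢ u≺v , ¬adj
    ; total     = total
    ; asym      = λ (_ , u≺v) (_ , v≺u) → ≺-irrefl (Lex.trans u≺v v≺u)
    ; trans     = ⇒-trans
    }
    where
    total : ∀ u v → u ≢ v → ¬ Adj G u v → (u ⇒ v) ⊎ (v ⇒ u)
    total u v u≢v ¬adj with ≢⇒≺⊎≻ u≢v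
    ... | inj₁ u≺v = inj₁ (¬adj , u≺v)
    ... | inj₂ v≺u = inj₂ (¬adj ∘ Graph.sym G , v≺u)

theorem4p1 : (k : ℕ) → 3 ≤ k → (n : ℕ) → (G : Graph n) →
    IsClassProperIntervalKGraph k G → IsCocomparability G
theorem4p1 k _ n G (R , proper) = ComplementOrientation.complementOrientation R proper
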